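{- Let $n,r\geq 3$ be integers, $G=C_n^r$, let $s=(2^r-1)(n-1)$, and let $\alpha_r\in[0,n-1]$ be the integer with $\alpha_r\equiv-2^{r-1}\pmod n$. Then \begin{enumerate} \item if $\alpha_r\neq 0$, then $C_0(G)\cap[s-(3n-3)-\alpha_r,\ s-\alpha_r]=\emptyset$; \item if $\alpha_r=0$, then $C_0(G)\cap[s-(3n-3),\ s-(n+1)]=\emptyset$. \end{enumerate}
   Context: $C_n^r$ is the direct sum of $r$ copies of the cyclic group $C_n$; $[a,b]=\{x\in\mathbb Z:a\le x\le b\}$. A sequence over $G$ is a finite unordered list of elements of $G$ with repetition allowed; length counts multiplicity. A short zero-sum sequence is a sequence with sum $0$ and length in $[1,\exp(G)]$. $D(G)$ is the smallest $d$ such that every sequence over $G$ of length $\ge d$ has a nonempty zero-sum subsequence; $\eta(G)$ is the smallest $d$ such that every sequence of length $\ge d$ has a short zero-sum subsequence. $C_0(G)$ is the set of integers $t\in[D(G)+1,\eta(G)-1]$ such that every zero-sum sequence over $G$ of length exactly $t$ contains a short zero-sum subsequence. -}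

module Defs where

open import Data.Nat using (ℕ; zero; suc; _+_; _≤_)
open import Data.Nat.Divisibility using (_∣_)
open import Data.Fin using (Fin; toℕ)
open import Data.Vec using (Vec; lookup)
open import Data.List using (List; []; _∷_; length)
open import Data.List.Relation.Binary.Sublist.Propositional using (_⊆_)
open import Data.Product using (Σ; _×_)

Elem : ℕ → ℕ → Set
Elem n r = Vec (Fin n) r

-- A sequence over G (finite unordered list with repetition; a List,
-- order is irrelevant to everything below).
Seq : ℕ → ℕ → Set
Seq n r = List (Elem n r)

-- i-th coordinate of the sum of a sequence, computed in ℕ (before reduction mod n).
coordSum : ∀ {n r} → Fin r → Seq n r → ℕ
coordSum i []      = 0
coordSum i (g ∷ S) = toℕ (lookup g i) + coordSum i S

ZeroSum : ∀ {n r} → Seq n r → Set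
ZeroSum {n} {r} S = (i : Fin r) → n ∣ coordSum i S

HasZS : ∀ {n r} → Seq n r → Set
HasZS {n} {r} S = Σ (Seq n r) λ T → T ⊆ S × 1 ≤ length T × ZeroSum T

-- S has a short zero-sum subsequence: length in [1, exp(G)] with exp(C_n^r) = n.
HasShortZS : ∀ {n r} → Seq n r → Set
HasShortZS {n} {r} S =
  Σ (Seq n r) λ T → T ⊆ S × 1 ≤ length T × length T ≤ n × ZeroSum T

IsLeast : (ℕ → Set) → ℕ → Set
IsLeast P d = P d × ((d' : ℕ) → P d' → d ≤ d')

IsDavenport : ℕ → ℕ → ℕ → Set
IsDavenport n r = IsLeast λ d → (S : Seq n r) → d ≤ length S → HasZS S

IsEta : ℕ → ℕ → ℕ → Set
IsEta n r = IsLeast λ e → (S : Seq n r) → e ≤ length S → HasShortZS S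

InC0 : ℕ → ℕ → ℕ → Set
InC0 n r t =
  Σ ℕ λ D → Σ ℕ λ η →
    IsDavenport n r D × IsEta n r η × D + 1 ≤ t × t + 1 ≤ η ×
    ((S : Seq n r) → ZeroSum S → length S ≡ t → HasShortZS S)
  where open import Relation.Binary.PropositionalEquality using (_≡_)

{-# OPTIONS --safe #-}
module Submission where

-- Start from every nonzero 0/1 vector of C_n^r, each taken n - 1 times: a sequence of
-- length s whose coordinate sums are 2^(r-1)(n-1) ≡ α (mod n).  A sequence of 0/1 vectors in
-- which no vector occurs n times has no short zero-sum subsequence: in such a subsequence every
-- coordinate sum is 0 or n, which forces all its terms to be equal.  Removing d_S copies of the
-- vectors supported on S ⊆ {0, 1, 2}, where 2 stands for the whole block of coordinates
-- 2, …, r - 1, with ∑_{S ∋ i} d_S ≡ α (mod n), keeps this property and yields a zero-sum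
-- sequence of length s - ∑ d_S; one extra term k·e₀ with k ≤ d_{0} adjusts the first
-- coordinate.  An explicit choice of the d_S for every j in the relevant ranges realises the
-- length s - α - j, so these lengths are not in C₀(G).

open import Defs
open import Data.Bool using (Bool; true; false)
open import Data.Empty using (⊥-elim)
open import Data.Fin using (Fin; zero; suc; toℕ; fromℕ<)
import Data.Fin as Fin
open import Data.Fin.Properties using (toℕ-injective; toℕ-fromℕ<)
open import Data.List using (List; []; _∷_; _++_; length; filter; replicate)
open import Data.List.Properties using (length-++; length-replicate; length-filter; filter-++; filter-all; filter-none)
open import Data.List.Relation.Unary.All as All using (All; []; _∷_)
open import Data.List.Relation.Unary.All.Properties using (++⁺; replicate⁺)
open import Data.List.Relation.Binary.Sublist.Propositional using (_⊆_; _∷_; _∷ʳ_)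
open import Data.List.Relation.Binary.Sublist.Propositional.Properties using (All-resp-⊆; filter⁺; length-mono-≤)
open import Data.Maybe using (Maybe; just; nothing; maybe)
open import Data.Nat using (ℕ; zero; suc; _+_; _*_; _∸_; _^_; _≤_; _<_; z≤n; s≤s; s≤s⁻¹; _<?_)
open import Data.Nat.Properties
open import Algebra.Properties.CommutativeSemigroup +-commutativeSemigroup
  using () renaming (interchange to +-interchange)
open import Data.Nat.Divisibility using (_∣_; divides; ∣⇒≤; >⇒∤; ∣m+n∣m⇒∣n; n∣m*n)
open import Data.Nat.Tactic.RingSolver using (solve-∀)
open import Data.Product using (Σ; ∃-syntax; _×_; _,_)
open import Data.Sum using (_⊎_; inj₁; inj₂)
open import Data.Vec using (Vec; []; _∷_; lookup; map) renaming (replicate to replicateᵥ)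
open import Data.Vec.Properties using (∷-injectiveʳ; ≡-dec; lookup-replicate; map-replicate)
open import Data.Vec.Relation.Binary.Pointwise.Extensional using (ext; Pointwise-≡⇒≡)
open import Function using (_∘_)
open import Relation.Binary using (tri<; tri≈; tri>)
open import Relation.Binary.PropositionalEquality
open import Relation.Nullary using (¬_; Dec; yes; no; contradiction)

sumCube : ∀ m → (Vec Bool m → ℕ) → ℕ
sumCube zero    f = f []
sumCube (suc m) f = sumCube m (f ∘ (true ∷_)) + sumCube m (f ∘ (false ∷_))

concatCube : ∀ {A : Set} m → (Vec Bool m → List A) → List A
concatCube zero    f = f []
concatCube (suc m) f = concatCube m (f ∘ (true ∷_)) ++ concatCube m (f ∘ (false ∷_))

bitValue : Bool → ℕ
bitValue true  = 1
bitValue false = 0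

sumCube-cong : ∀ m {f g : Vec Bool m → ℕ} → (∀ b → f b ≡ g b) → sumCube m f ≡ sumCube m g
sumCube-cong zero    f≗g = f≗g []
sumCube-cong (suc m) f≗g =
  cong₂ _+_ (sumCube-cong m (f≗g ∘ (true ∷_))) (sumCube-cong m (f≗g ∘ (false ∷_)))

2^m*c+2^m*c≡2^[1+m]*c : ∀ m c → 2 ^ m * c + 2 ^ m * c ≡ 2 ^ suc m * c
2^m*c+2^m*c≡2^[1+m]*c m c = begin
  2 ^ m * c + 2 ^ m * c       ≡⟨ cong (2 ^ m * c +_) (+-identityʳ _) ⟨
  2 * (2 ^ m * c)             ≡⟨ *-assoc 2 (2 ^ m) c ⟨
  2 ^ suc m * c               ∎
  where open ≡-Reasoning

sumCube-zero : ∀ m {f : Vec Bool m → ℕ} → (∀ b → f b ≡ 0) → sumCube m f ≡ 0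
sumCube-zero zero    f≗0 = f≗0 []
sumCube-zero (suc m) f≗0 =
  cong₂ _+_ (sumCube-zero m (f≗0 ∘ (true ∷_))) (sumCube-zero m (f≗0 ∘ (false ∷_)))

sumCube-point : ∀ m (w : Vec Bool m) {f : Vec Bool m → ℕ} →
                (∀ b → b ≢ w → f b ≡ 0) → sumCube m f ≡ f w
sumCube-point zero    []          _   = refl
sumCube-point (suc m) (true ∷ w)  f≗0 = trans
  (cong₂ _+_ (sumCube-point m w λ t t≢w → f≗0 (true ∷ t) (t≢w ∘ ∷-injectiveʳ))
             (sumCube-zero m λ t → f≗0 (false ∷ t) λ ()))
  (+-identityʳ _)
sumCube-point (suc m) (false ∷ w) f≗0 =
  cong₂ _+_ (sumCube-zero m λ t → f≗0 (true ∷ t) λ ())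
            (sumCube-point m w λ t t≢w → f≗0 (false ∷ t) (t≢w ∘ ∷-injectiveʳ))

sumCube-complement : ∀ m {f g : Vec Bool m → ℕ} {c} → (∀ b → f b + g b ≡ c) →
                     sumCube m f + sumCube m g ≡ 2 ^ m * c
sumCube-complement zero    f+g≡c = trans (f+g≡c []) (sym (+-identityʳ _))
sumCube-complement (suc m) {f} {g} {c} f+g≡c = begin
  (F true + F false) + (G true + G false) ≡⟨ +-interchange (F true) (F false) (G true) (G false) ⟩
  (F true + G true) + (F false + G false)
    ≡⟨ cong₂ _+_ (sumCube-complement m {f ∘ (true ∷_)} {g ∘ (true ∷_)} (f+g≡c ∘ (true ∷_)))
                 (sumCube-complement m {f ∘ (false ∷_)} {g ∘ (false ∷_)} (f+g≡c ∘ (false ∷_))) ⟩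
  2 ^ m * c + 2 ^ m * c ≡⟨ 2^m*c+2^m*c≡2^[1+m]*c m c ⟩
  2 ^ suc m * c ∎
  where
  open ≡-Reasoning
  F G : Bool → ℕ
  F x = sumCube m (f ∘ (x ∷_))
  G x = sumCube m (g ∘ (x ∷_))

sumCube-head : ∀ m (f : Vec Bool (suc m) → ℕ) →
               sumCube (suc m) (λ b → f b * bitValue (lookup b zero)) ≡ sumCube m (f ∘ (true ∷_))
sumCube-head m f = begin
  sumCube m (λ t → f (true ∷ t) * 1) + sumCube m (λ t → f (false ∷ t) * 0)
    ≡⟨ cong₂ _+_ (sumCube-cong m λ t → *-identityʳ (f (true ∷ t)))
                 (sumCube-zero m λ t → *-zeroʳ (f (false ∷ t))) ⟩
  sumCube m (f ∘ (true ∷_)) + 0 ≡⟨ +-identityʳ _ ⟩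
  sumCube m (f ∘ (true ∷_)) ∎
  where open ≡-Reasoning

sumCube-complement-coordinate :
  ∀ m {f g : Vec Bool (suc m) → ℕ} {c} → (∀ b → f b + g b ≡ c) → (i : Fin (suc m)) →
  sumCube (suc m) (λ b → f b * bitValue (lookup b i)) +
  sumCube (suc m) (λ b → g b * bitValue (lookup b i)) ≡ 2 ^ m * c
sumCube-complement-coordinate m {f} {g} f+g≡c zero
  rewrite sumCube-head m f | sumCube-head m g = sumCube-complement m (f+g≡c ∘ (true ∷_))
sumCube-complement-coordinate (suc m) {f} {g} {c} f+g≡c (suc i) = begin
  (F true + F false) + (G true + G false) ≡⟨ +-interchange (F true) (F false) (G true) (G false) ⟩
  (F true + G true) + (F false + G false)
    ≡⟨ cong₂ _+_ (sumCube-complement-coordinate m {f ∘ (true ∷_)} {g ∘ (true ∷_)} (f+g≡c ∘ (true ∷_)) i)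
                 (sumCube-complement-coordinate m {f ∘ (false ∷_)} {g ∘ (false ∷_)} (f+g≡c ∘ (false ∷_)) i) ⟩
  2 ^ m * c + 2 ^ m * c ≡⟨ 2^m*c+2^m*c≡2^[1+m]*c m c ⟩
  2 ^ suc m * c ∎
  where
  open ≡-Reasoning
  F G : Bool → ℕ
  F x = sumCube (suc m) (λ t → f (x ∷ t) * bitValue (lookup t i))
  G x = sumCube (suc m) (λ t → g (x ∷ t) * bitValue (lookup t i))

consConstant : Bool → Maybe Bool → Maybe Bool
consConstant true  (just true)  = just true
consConstant false (just false) = just false
consConstant _     _            = nothing

constantValue : ∀ {m} → Vec Bool (suc m) → Maybe Bool
constantValue (x ∷ [])    = just x
constantValue (x ∷ y ∷ t) = consConstant x (constantValue (y ∷ t))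

constantValue-∷ : ∀ {m} x (t : Vec Bool (suc m)) → constantValue (x ∷ t) ≡ consConstant x (constantValue t)
constantValue-∷ x (_ ∷ _) = refl

constantValue-replicate : ∀ m x → constantValue (replicateᵥ (suc m) x) ≡ just x
constantValue-replicate zero    x     = refl
constantValue-replicate (suc m) true  = cong (consConstant true) (constantValue-replicate m true)
constantValue-replicate (suc m) false = cong (consConstant false) (constantValue-replicate m false)

sumCube-constantValue-∷ : ∀ m x (G : Maybe Bool → ℕ) → G nothing ≡ 0 →
                          sumCube m (λ t → G (constantValue (x ∷ t))) ≡ G (just x)
sumCube-constantValue-∷ zero    x     G G-nothing = refl
sumCube-constantValue-∷ (suc m) true  G G-nothing = begin
  sumCube m (λ t → G (consConstant true (constantValue (true ∷ t)))) +
  sumCube m (λ t → G (consConstant true (constantValue (false ∷ t))))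
    ≡⟨ cong₂ _+_ (sumCube-constantValue-∷ m true (G ∘ consConstant true) G-nothing)
                 (sumCube-constantValue-∷ m false (G ∘ consConstant true) G-nothing) ⟩
  G (just true) + G nothing ≡⟨ cong (G (just true) +_) G-nothing ⟩
  G (just true) + 0         ≡⟨ +-identityʳ _ ⟩
  G (just true)             ∎
  where open ≡-Reasoning
sumCube-constantValue-∷ (suc m) false G G-nothing =
  cong₂ _+_ (trans (sumCube-constantValue-∷ m true (G ∘ consConstant false) G-nothing) G-nothing)
            (sumCube-constantValue-∷ m false (G ∘ consConstant false) G-nothing)

sumCube-constantValue : ∀ m (G : Maybe Bool → ℕ) → G nothing ≡ 0 →
                        sumCube (suc m) (G ∘ constantValue) ≡ G (just true) + G (just false)
sumCube-constantValue m G G-nothing =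
  cong₂ _+_ (sumCube-constantValue-∷ m true G G-nothing) (sumCube-constantValue-∷ m false G G-nothing)

sumCube-constantValue-coordinate :
  ∀ m (G : Maybe Bool → ℕ) → G nothing ≡ 0 → (i : Fin (suc m)) →
  sumCube (suc m) (λ t → G (constantValue t) * bitValue (lookup t i)) ≡ G (just true)
sumCube-constantValue-coordinate m G G-nothing zero =
  trans (sumCube-head m (G ∘ constantValue)) (sumCube-constantValue-∷ m true G G-nothing)
sumCube-constantValue-coordinate (suc m) G G-nothing (suc i) = begin
  sumCube (suc m) (λ t → G (constantValue (true ∷ t)) * bitValue (lookup t i)) +
  sumCube (suc m) (λ t → G (constantValue (false ∷ t)) * bitValue (lookup t i))
    ≡⟨ cong₂ _+_ (sumCube-cong (suc m) λ t → cong (λ v → G v * bitValue (lookup t i)) (constantValue-∷ true t))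
                 (sumCube-cong (suc m) λ t → cong (λ v → G v * bitValue (lookup t i)) (constantValue-∷ false t)) ⟩
  sumCube (suc m) (λ t → G (consConstant true (constantValue t)) * bitValue (lookup t i)) +
  sumCube (suc m) (λ t → G (consConstant false (constantValue t)) * bitValue (lookup t i))
    ≡⟨ cong₂ _+_ (sumCube-constantValue-coordinate m (G ∘ consConstant true) G-nothing i)
                 (sumCube-constantValue-coordinate m (G ∘ consConstant false) G-nothing i) ⟩
  G (just true) + G nothing ≡⟨ cong (G (just true) +_) G-nothing ⟩
  G (just true) + 0         ≡⟨ +-identityʳ _ ⟩
  G (just true)             ∎
  where open ≡-Reasoning

entry : ∀ {n r} → Elem n r → Fin r → ℕ
entry v i = toℕ (lookup v i)

_≟ₑ_ : ∀ {n r} (u v : Elem n r) → Dec (u ≡ v)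
_≟ₑ_ = ≡-dec Fin._≟_

count : ∀ {n r} → Elem n r → Seq n r → ℕ
count u S = length (filter (_≟ₑ u) S)

module _ {n r : ℕ} where

  coordSum-++ : ∀ i (S T : Seq n r) → coordSum i (S ++ T) ≡ coordSum i S + coordSum i T
  coordSum-++ i []      T = refl
  coordSum-++ i (v ∷ S) T = trans (cong (entry v i +_) (coordSum-++ i S T)) (sym (+-assoc (entry v i) _ _))

  coordSum-replicate : ∀ i c (v : Elem n r) → coordSum i (replicate c v) ≡ c * entry v i
  coordSum-replicate i zero    v = refl
  coordSum-replicate i (suc c) v = cong (entry v i +_) (coordSum-replicate i c v)

  length-concatCube : ∀ m (f : Vec Bool m → Seq n r) → length (concatCube m f) ≡ sumCube m (length ∘ f)
  length-concatCube zero    f = refl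
  length-concatCube (suc m) f = trans (length-++ (concatCube m (f ∘ (true ∷_))))
    (cong₂ _+_ (length-concatCube m (f ∘ (true ∷_))) (length-concatCube m (f ∘ (false ∷_))))

  coordSum-concatCube : ∀ i m (f : Vec Bool m → Seq n r) →
                        coordSum i (concatCube m f) ≡ sumCube m (coordSum i ∘ f)
  coordSum-concatCube i zero    f = refl
  coordSum-concatCube i (suc m) f = trans (coordSum-++ i (concatCube m (f ∘ (true ∷_))) _)
    (cong₂ _+_ (coordSum-concatCube i m (f ∘ (true ∷_))) (coordSum-concatCube i m (f ∘ (false ∷_))))

  count-concatCube : ∀ u m (f : Vec Bool m → Seq n r) → count u (concatCube m f) ≡ sumCube m (count u ∘ f)
  count-concatCube u zero    f = refl
  count-concatCube u (suc m) f = begin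
    length (filter (_≟ₑ u) (concatCube m (f ∘ (true ∷_)) ++ concatCube m (f ∘ (false ∷_))))
      ≡⟨ cong length (filter-++ (_≟ₑ u) (concatCube m (f ∘ (true ∷_))) _) ⟩
    length (filter (_≟ₑ u) (concatCube m (f ∘ (true ∷_))) ++ filter (_≟ₑ u) (concatCube m (f ∘ (false ∷_))))
      ≡⟨ length-++ (filter (_≟ₑ u) (concatCube m (f ∘ (true ∷_)))) ⟩
    count u (concatCube m (f ∘ (true ∷_))) + count u (concatCube m (f ∘ (false ∷_)))
      ≡⟨ cong₂ _+_ (count-concatCube u m (f ∘ (true ∷_))) (count-concatCube u m (f ∘ (false ∷_))) ⟩
    sumCube (suc m) (count u ∘ f) ∎
    where open ≡-Reasoning

  All-concatCube : ∀ {P : Elem n r → Set} m (f : Vec Bool m → Seq n r) →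
                   (∀ b → All P (f b)) → All P (concatCube m f)
  All-concatCube zero    f all = all []
  All-concatCube (suc m) f all = ++⁺ (All-concatCube m (f ∘ (true ∷_)) (all ∘ (true ∷_)))
                                     (All-concatCube m (f ∘ (false ∷_)) (all ∘ (false ∷_)))

  count-replicate-≤ : ∀ u c (v : Elem n r) → count u (replicate c v) ≤ c
  count-replicate-≤ u c v = ≤-trans (length-filter (_≟ₑ u) (replicate c v)) (≤-reflexive (length-replicate c))

  count-replicate-≢ : ∀ u c (v : Elem n r) → v ≢ u → count u (replicate c v) ≡ 0
  count-replicate-≢ u c v v≢u = cong length (filter-none (_≟ₑ u) (replicate⁺ c v≢u))

  count-mono : ∀ u {S T : Seq n r} → S ⊆ T → count u S ≤ count u T
  count-mono u S⊆T = length-mono-≤ (filter⁺ (_≟ₑ u) (_≟ₑ u) (λ v≡w v≡u → trans (sym v≡w) v≡u) S⊆T)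

  count-all : ∀ u {S : Seq n r} → All (_≡ u) S → count u S ≡ length S
  count-all u S≡u = cong length (filter-all (_≟ₑ u) S≡u)

-- Sequences of 0/1 vectors without short zero-sum subsequences

ZeroOne : ∀ {n r} → Elem n r → Set
ZeroOne v = ∀ i → entry v i ≤ 1

Nonzero : ∀ {n r} → Elem n r → Set
Nonzero v = ∃[ i ] entry v i ≡ 1

multiple<⇒≡0 : ∀ {n σ} → n ∣ σ → σ < n → σ ≡ 0
multiple<⇒≡0 {σ = zero}  _   _   = refl
multiple<⇒≡0 {σ = suc _} n∣σ σ<n = contradiction n∣σ (>⇒∤ σ<n)

Elem-ext : ∀ {n r} {u v : Elem n r} → (∀ i → entry u i ≡ entry v i) → u ≡ v
Elem-ext u≗v = Pointwise-≡⇒≡ (ext (toℕ-injective ∘ u≗v))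

module _ {n r : ℕ} (i : Fin r) where

  coordSum≤length : {S : Seq n r} → All ZeroOne S → coordSum i S ≤ length S
  coordSum≤length []         = z≤n
  coordSum≤length (v01 ∷ S01) = +-mono-≤ (v01 i) (coordSum≤length S01)

  coordSum≡0⇒entries≡0 : (S : Seq n r) → coordSum i S ≡ 0 → All (λ v → entry v i ≡ 0) S
  coordSum≡0⇒entries≡0 []      _  = []
  coordSum≡0⇒entries≡0 (v ∷ S) σ≡0 =
    m+n≡0⇒m≡0 (entry v i) σ≡0 ∷ coordSum≡0⇒entries≡0 S (m+n≡0⇒n≡0 (entry v i) σ≡0)

  coordSum≡length⇒entries≡1 : {S : Seq n r} → All ZeroOne S → coordSum i S ≡ length S →
                               All (λ v → entry v i ≡ 1) S
  coordSum≡length⇒entries≡1 []                  _ = []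
  coordSum≡length⇒entries≡1 {v ∷ S} (v01 ∷ S01) σ≡ℓ with entry v i in vᵢ | v01 i
  ... | zero          | _       = ⊥-elim (n≮n _ (subst (_≤ length S) σ≡ℓ (coordSum≤length S01)))
  ... | suc zero      | _       = vᵢ ∷ coordSum≡length⇒entries≡1 S01 (suc-injective σ≡ℓ)
  ... | suc (suc _)   | s≤s ()

  entries≡1⇒coordSum≡length : {S : Seq n r} → All (λ v → entry v i ≡ 1) S → coordSum i S ≡ length S
  entries≡1⇒coordSum≡length []           = refl
  entries≡1⇒coordSum≡length (vᵢ≡1 ∷ S≡1) = cong₂ _+_ vᵢ≡1 (entries≡1⇒coordSum≡length S≡1)

  zeroOne-coordinate-dichotomy :
    {S : Seq n r} → All ZeroOne S → length S ≤ n → n ∣ coordSum i S →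
    All (λ v → entry v i ≡ 0) S ⊎ (All (λ v → entry v i ≡ 1) S × length S ≡ n)
  zeroOne-coordinate-dichotomy {S} S01 ℓ≤n n∣σ with coordSum i S in σ≡ | coordSum≤length S01
  ... | zero  | _   = inj₁ (coordSum≡0⇒entries≡0 S σ≡)
  ... | suc _ | σ≤ℓ = inj₂ (coordSum≡length⇒entries≡1 S01 (trans σ≡ σ≡ℓ) , ℓ≡n)
    where
    n≤σ = ∣⇒≤ n∣σ
    σ≡ℓ = ≤-antisym σ≤ℓ (≤-trans ℓ≤n n≤σ)
    ℓ≡n = ≤-antisym ℓ≤n (≤-trans n≤σ σ≤ℓ)

zeroOne-shortZeroSumFree :
  ∀ {n r} (L : Seq n r) → All ZeroOne L → All Nonzero L → All (λ u → count u L < n) L → ¬ HasShortZS L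
zeroOne-shortZeroSumFree L L01 L≠0 Lrare ([] , _ , () , _)
zeroOne-shortZeroSumFree {n} L L01 L≠0 Lrare (u ∷ U , T⊆L , _ , ℓ≤n , zeroSum) = n≮n n (begin-strict
  n         ≡⟨ length-T (All.head (All-resp-⊆ T⊆L L≠0)) ⟨
  length T  ≡⟨ count-all u T≡u ⟨
  count u T ≤⟨ count-mono u T⊆L ⟩
  count u L <⟨ All.head (All-resp-⊆ T⊆L Lrare) ⟩
  n         ∎)
  where
  open ≤-Reasoning
  T = u ∷ U
  dichotomy : ∀ i → All (λ v → entry v i ≡ 0) T ⊎ (All (λ v → entry v i ≡ 1) T × length T ≡ n)
  dichotomy i = zeroOne-coordinate-dichotomy i (All-resp-⊆ T⊆L L01) ℓ≤n (zeroSum i)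

  agrees : ∀ i → All (λ v → entry v i ≡ entry u i) T
  agrees i with dichotomy i
  ... | inj₁ T≡0       = All.map (λ vᵢ≡0 → trans vᵢ≡0 (sym (All.head T≡0))) T≡0
  ... | inj₂ (T≡1 , _) = All.map (λ vᵢ≡1 → trans vᵢ≡1 (sym (All.head T≡1))) T≡1

  T≡u : All (_≡ u) T
  T≡u = All.tabulate λ v∈T → Elem-ext λ i → All.lookup (agrees i) v∈T

  length-T : Nonzero u → length T ≡ n
  length-T (p , uₚ≡1) with dichotomy p
  ... | inj₁ T≡0       = contradiction (trans (sym uₚ≡1) (All.head T≡0)) λ ()
  ... | inj₂ (_ , ℓ≡n) = ℓ≡n

axial : ∀ {n r} → Fin (suc n) → Elem (suc n) (suc r)
axial a = a ∷ replicateᵥ _ zero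

entry-axial-suc : ∀ {n r} (a : Fin (suc n)) (i : Fin r) → entry (axial a) (suc i) ≡ 0
entry-axial-suc a i = cong toℕ (lookup-replicate i zero)

e₀ : ∀ {n r} → Elem (suc (suc n)) (suc r)
e₀ = axial (suc zero)

module _ {n r : ℕ} where

  private
    N : ℕ
    N = suc (suc n)

  nonzero-on-axis⇒e₀ : {v : Elem N (suc r)} → Nonzero v → (∀ i → entry v (suc i) ≡ 0) → v ≡ e₀
  nonzero-on-axis⇒e₀ (zero , v₀≡1) off = Elem-ext λ where
    zero    → v₀≡1
    (suc i) → trans (off i) (sym (entry-axial-suc (suc zero) i))
  nonzero-on-axis⇒e₀ (suc p , vₚ≡1) off = contradiction (trans (sym vₚ≡1) (off p)) λ ()

  -- A short zero-sum subsequence through k·e₀ has all its other terms equal to e₀ (its other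
  -- coordinates sum to less than n), so its first coordinate sum lies strictly between 0 and n.
  axial-shortZeroSumFree :
    (L : Seq N (suc r)) → All ZeroOne L → All Nonzero L → All (λ u → count u L < N) L →
    (k : Fin N) → 1 ≤ toℕ k → count e₀ L + toℕ k < N → ¬ HasShortZS (axial k ∷ L)
  axial-shortZeroSumFree L L01 L≠0 Lrare k 1≤k rare (T , _ ∷ʳ T⊆L , T-short) =
    zeroOne-shortZeroSumFree L L01 L≠0 Lrare (T , T⊆L , T-short)
  axial-shortZeroSumFree L L01 L≠0 Lrare k 1≤k rare (_ ∷ U , refl ∷ U⊆L , _ , s≤s ℓ≤n , zeroSum) =
    <⇒≢ 1≤k (sym (m+n≡0⇒m≡0 (toℕ k) (multiple<⇒≡0 (zeroSum zero) σ₀<N)))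
    where
    offAxis : ∀ i → All (λ v → entry v (suc i) ≡ 0) U
    offAxis i = coordSum≡0⇒entries≡0 (suc i) U (multiple<⇒≡0 N∣σ σ<N)
      where
      N∣σ : N ∣ coordSum (suc i) U
      N∣σ = subst (λ x → N ∣ x + coordSum (suc i) U) (entry-axial-suc k i) (zeroSum (suc i))
      σ<N = s≤s (≤-trans (coordSum≤length (suc i) (All-resp-⊆ U⊆L L01)) ℓ≤n)

    U≡e₀ : All (_≡ e₀) U
    U≡e₀ = All.tabulate λ v∈U →
      nonzero-on-axis⇒e₀ (All.lookup (All-resp-⊆ U⊆L L≠0) v∈U) (λ i → All.lookup (offAxis i) v∈U)

    σ₀<N : coordSum zero (axial k ∷ U) < N
    σ₀<N = begin-strict
      toℕ k + coordSum zero U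
        ≡⟨ cong (toℕ k +_) (entries≡1⇒coordSum≡length zero (All.map (cong (λ w → entry w zero)) U≡e₀)) ⟩
      toℕ k + length U        ≡⟨ cong (toℕ k +_) (count-all e₀ U≡e₀) ⟨
      toℕ k + count e₀ U      ≤⟨ +-monoʳ-≤ (toℕ k) (count-mono e₀ U⊆L) ⟩
      toℕ k + count e₀ L      ≡⟨ +-comm (toℕ k) _ ⟩
      count e₀ L + toℕ k      <⟨ rare ⟩
      N                       ∎
      where open ≤-Reasoning

-- Cube sequences: every 0/1 vector with a prescribed multiplicity

bitFin : ∀ {n} → Bool → Fin (suc (suc n))
bitFin true  = suc zero
bitFin false = zero

fromBits : ∀ {n r} → Vec Bool r → Elem (suc (suc n)) r
fromBits = map bitFin

module _ {n : ℕ} where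

  entry-fromBits : ∀ {r} (b : Vec Bool r) i → entry (fromBits {n} b) i ≡ bitValue (lookup b i)
  entry-fromBits (true  ∷ b) zero    = refl
  entry-fromBits (false ∷ b) zero    = refl
  entry-fromBits (x     ∷ b) (suc i) = entry-fromBits b i

  fromBits-injective : ∀ {r} {b w : Vec Bool r} → fromBits {n} b ≡ fromBits w → b ≡ w
  fromBits-injective {b = []}        {[]}        _  = refl
  fromBits-injective {b = true  ∷ b} {true  ∷ w} eq = cong (true ∷_) (fromBits-injective (∷-injectiveʳ eq))
  fromBits-injective {b = false ∷ b} {false ∷ w} eq = cong (false ∷_) (fromBits-injective (∷-injectiveʳ eq))
  fromBits-injective {b = true  ∷ b} {false ∷ w} ()
  fromBits-injective {b = false ∷ b} {true  ∷ w} ()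

  fromBits-zeroOne : ∀ {r} (b : Vec Bool r) → ZeroOne (fromBits {n} b)
  fromBits-zeroOne b i rewrite entry-fromBits b i with lookup b i
  ... | true  = ≤-refl
  ... | false = z≤n

  fromBits-zero-or-nonzero : ∀ {r} (b : Vec Bool r) → b ≡ replicateᵥ r false ⊎ Nonzero (fromBits {n} b)
  fromBits-zero-or-nonzero []          = inj₁ refl
  fromBits-zero-or-nonzero (true  ∷ b) = inj₂ (zero , refl)
  fromBits-zero-or-nonzero (false ∷ b) with fromBits-zero-or-nonzero b
  ... | inj₁ b≡0       = inj₁ (cong (false ∷_) b≡0)
  ... | inj₂ (i , bᵢ≡1) = inj₂ (suc i , bᵢ≡1)

module _ {n r : ℕ} (mult : Vec Bool r → ℕ) where

  cubeSeq : Seq (suc (suc n)) r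
  cubeSeq = concatCube r (λ b → replicate (mult b) (fromBits b))

  length-cubeSeq : length cubeSeq ≡ sumCube r mult
  length-cubeSeq = trans (length-concatCube r _) (sumCube-cong r λ b → length-replicate (mult b))

  coordSum-cubeSeq : ∀ i → coordSum i cubeSeq ≡ sumCube r (λ b → mult b * bitValue (lookup b i))
  coordSum-cubeSeq i = trans (coordSum-concatCube i r _) (sumCube-cong r λ b →
    trans (coordSum-replicate i (mult b) (fromBits b)) (cong (mult b *_) (entry-fromBits b i)))

  count-cubeSeq : ∀ w → count (fromBits w) cubeSeq ≤ mult w
  count-cubeSeq w = begin
    count (fromBits w) cubeSeq                                    ≡⟨ count-concatCube (fromBits w) r _ ⟩
    sumCube r (λ b → count (fromBits w) (replicate (mult b) (fromBits b)))
      ≡⟨ sumCube-point r w (λ b b≢w →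
           count-replicate-≢ (fromBits w) (mult b) (fromBits b) (b≢w ∘ fromBits-injective)) ⟩
    count (fromBits w) (replicate (mult w) (fromBits w))
      ≤⟨ count-replicate-≤ (fromBits w) (mult w) (fromBits w) ⟩
    mult w ∎
    where open ≤-Reasoning

  cubeSeq-zeroOne : All ZeroOne cubeSeq
  cubeSeq-zeroOne = All-concatCube r _ λ b → replicate⁺ (mult b) (fromBits-zeroOne b)

  cubeSeq-nonzero : mult (replicateᵥ r false) ≡ 0 → All Nonzero cubeSeq
  cubeSeq-nonzero mult-0≡0 = All-concatCube r _ λ b → nonzero-block b (fromBits-zero-or-nonzero b)
    where
    nonzero-block : ∀ b → b ≡ replicateᵥ r false ⊎ Nonzero (fromBits {n} b) →
                    All Nonzero (replicate (mult b) (fromBits {n} b))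
    nonzero-block b (inj₁ refl) rewrite mult-0≡0 = []
    nonzero-block b (inj₂ b≢0) = replicate⁺ (mult b) b≢0

  cubeSeq-count<n : (∀ b → mult b < suc (suc n)) → All (λ u → count u cubeSeq < suc (suc n)) cubeSeq
  cubeSeq-count<n mult<n = All-concatCube r _ λ b →
    replicate⁺ (mult b) (≤-<-trans (count-cubeSeq b) (mult<n b))

-- Removing deficits from the full cube sequence

data Extra (d₀ : ℕ) : Set where
  noExtra : Extra d₀
  extra   : (k : ℕ) → 1 ≤ k → k ≤ d₀ → Extra d₀

extraValue : ∀ {d₀} → Extra d₀ → ℕ
extraValue noExtra       = 0
extraValue (extra k _ _) = k

extraCount : ∀ {d₀} → Extra d₀ → ℕ
extraCount noExtra       = 0
extraCount (extra _ _ _) = 1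

-- d_S copies are removed from the n₁ copies of each 0/1 vector whose entries on coordinates
-- 2, …, r - 1 all agree; S records which of coordinate 0, coordinate 1 and that block are 1.
-- The extra term, if any, is k·e₀.
record Deficits (n₁ α j : ℕ) : Set where
  field
    d₀ d₁ d₂ d₀₁ d₀₂ d₁₂ d₀₁₂ : ℕ
    d₀≤n₁   : d₀ ≤ n₁
    d₁≤n₁   : d₁ ≤ n₁
    d₂≤n₁   : d₂ ≤ n₁
    d₀₁≤n₁  : d₀₁ ≤ n₁
    d₀₂≤n₁  : d₀₂ ≤ n₁
    d₁₂≤n₁  : d₁₂ ≤ n₁
    d₀₁₂≤n₁ : d₀₁₂ ≤ n₁
    added   : Extra d₀
    m₀ m₁ m₂ : ℕ
    deficit₀ : d₀ + d₀₁ + d₀₂ + d₀₁₂ ≡ α + extraValue added + m₀ * suc n₁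
    deficit₁ : d₁ + d₀₁ + d₁₂ + d₀₁₂ ≡ α + m₁ * suc n₁
    deficit₂ : d₂ + d₀₂ + d₁₂ + d₀₁₂ ≡ α + m₂ * suc n₁
    deficit-total : d₀ + d₁ + d₂ + d₀₁ + d₀₂ + d₁₂ + d₀₁₂ ≡ α + j + extraCount added

divides-complement : ∀ {n₁ σ D P α k m} → σ + D ≡ P * n₁ → D ≡ α + k + m * suc n₁ →
                     suc n₁ ∣ α + P → suc n₁ ∣ k + σ
divides-complement {n₁} {σ} {D} {P} {α} {k} {m} σ+D≡ D≡ (divides q α+P≡) =
  ∣m+n∣m⇒∣n (divides P (begin
    (m + q) * N + (k + σ)        ≡⟨ regroup₁ m q N k σ ⟩
    σ + (k + m * N) + q * N      ≡⟨ cong (σ + (k + m * N) +_) α+P≡ ⟨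
    σ + (k + m * N) + (α + P)    ≡⟨ regroup₂ σ k m N α P ⟩
    σ + (α + k + m * N) + P      ≡⟨ cong (λ x → σ + x + P) D≡ ⟨
    σ + D + P                    ≡⟨ cong (_+ P) σ+D≡ ⟩
    P * n₁ + P                   ≡⟨ +-comm (P * n₁) P ⟩
    P + P * n₁                   ≡⟨ *-suc P n₁ ⟨
    P * N                        ∎))
  (n∣m*n (m + q))
  where
  open ≡-Reasoning
  N = suc n₁
  regroup₁ : ∀ m q N k σ → (m + q) * N + (k + σ) ≡ σ + (k + m * N) + q * N
  regroup₁ = solve-∀
  regroup₂ : ∀ σ k m N α P → σ + (k + m * N) + (α + P) ≡ σ + (α + k + m * N) + P
  regroup₂ = solve-∀

length-complement : ∀ {ℓ T n₁ p f α j} → ℓ + T ≡ p * n₁ → T ≡ α + j + f + n₁ → 1 ≤ p →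
                    f + ℓ + α + j ≡ (p ∸ 1) * n₁
length-complement {ℓ} {T} {n₁} {suc p} {f} {α} {j} ℓ+T≡ T≡ _ = +-cancelʳ-≡ n₁ _ _ (begin
  f + ℓ + α + j + n₁    ≡⟨ regroup f ℓ α j n₁ ⟩
  ℓ + (α + j + f + n₁)  ≡⟨ cong (ℓ +_) T≡ ⟨
  ℓ + T                 ≡⟨ ℓ+T≡ ⟩
  n₁ + p * n₁           ≡⟨ +-comm n₁ (p * n₁) ⟩
  p * n₁ + n₁           ∎)
  where
  open ≡-Reasoning
  regroup : ∀ f ℓ α j n₁ → f + ℓ + α + j + n₁ ≡ ℓ + (α + j + f + n₁)
  regroup = solve-∀

ShortFreeZeroSum : ℕ → ℕ → ℕ → Set
ShortFreeZeroSum n r t = Σ (Seq n r) λ S → ZeroSum S × length S ≡ t × ¬ HasShortZS S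

module _ {n₂ r′ α j : ℕ} (D : Deficits (suc n₂) α j) where

  open Deficits D

  private
    n₁ N r : ℕ
    n₁ = suc n₂
    N  = suc n₁
    r  = suc (suc (suc r′))

  deficitOfPattern : Bool → Bool → Bool → ℕ
  deficitOfPattern true  true  true  = d₀₁₂
  deficitOfPattern true  true  false = d₀₁
  deficitOfPattern true  false true  = d₀₂
  deficitOfPattern true  false false = d₀
  deficitOfPattern false true  true  = d₁₂
  deficitOfPattern false true  false = d₁
  deficitOfPattern false false true  = d₂
  deficitOfPattern false false false = n₁   -- removes the zero vector entirely

  deficit : Vec Bool r → ℕ
  deficit (x ∷ y ∷ t) = maybe (deficitOfPattern x y) 0 (constantValue t)

  multiplicity : Vec Bool r → ℕ
  multiplicity b = n₁ ∸ deficit b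

  baseSeq : Seq N r
  baseSeq = cubeSeq multiplicity

  deficitOfPattern≤n₁ : ∀ x y z → deficitOfPattern x y z ≤ n₁
  deficitOfPattern≤n₁ true  true  true  = d₀₁₂≤n₁
  deficitOfPattern≤n₁ true  true  false = d₀₁≤n₁
  deficitOfPattern≤n₁ true  false true  = d₀₂≤n₁
  deficitOfPattern≤n₁ true  false false = d₀≤n₁
  deficitOfPattern≤n₁ false true  true  = d₁₂≤n₁
  deficitOfPattern≤n₁ false true  false = d₁≤n₁
  deficitOfPattern≤n₁ false false true  = d₂≤n₁
  deficitOfPattern≤n₁ false false false = ≤-refl

  multiplicity+deficit : ∀ b → multiplicity b + deficit b ≡ n₁
  multiplicity+deficit (x ∷ y ∷ t) = m∸n+n≡m (deficit≤n₁ (constantValue t))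
    where
    deficit≤n₁ : ∀ c → maybe (deficitOfPattern x y) 0 c ≤ n₁
    deficit≤n₁ nothing  = z≤n
    deficit≤n₁ (just z) = deficitOfPattern≤n₁ x y z

  sumCube-pattern : ∀ x y → sumCube (suc r′) (λ t → deficit (x ∷ y ∷ t)) ≡
                            deficitOfPattern x y true + deficitOfPattern x y false
  sumCube-pattern x y = sumCube-constantValue r′ (maybe (deficitOfPattern x y) 0) refl

  sumCube-pattern-coordinate : ∀ x y i → sumCube (suc r′) (λ t → deficit (x ∷ y ∷ t) * bitValue (lookup t i)) ≡
                                         deficitOfPattern x y true
  sumCube-pattern-coordinate x y = sumCube-constantValue-coordinate r′ (maybe (deficitOfPattern x y) 0) refl

  sumCube-deficit : sumCube r deficit ≡ d₀₁₂ + d₀₁ + (d₀₂ + d₀) + (d₁₂ + d₁ + (d₂ + n₁))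
  sumCube-deficit = cong₂ _+_ (cong₂ _+_ (sumCube-pattern true true) (sumCube-pattern true false))
                              (cong₂ _+_ (sumCube-pattern false true) (sumCube-pattern false false))

  coordinateDeficit : Fin r → ℕ
  coordinateDeficit i = sumCube r (λ b → deficit b * bitValue (lookup b i))

  coordinateDeficit-0 : coordinateDeficit zero ≡ d₀₁₂ + d₀₁ + (d₀₂ + d₀)
  coordinateDeficit-0 = trans (sumCube-head (suc (suc r′)) deficit)
                     (cong₂ _+_ (sumCube-pattern true true) (sumCube-pattern true false))

  coordinateDeficit-1 : coordinateDeficit (suc zero) ≡ d₀₁₂ + d₀₁ + (d₁₂ + d₁)
  coordinateDeficit-1 = cong₂ _+_ (trans (sumCube-head (suc r′) (deficit ∘ (true ∷_))) (sumCube-pattern true true))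
                         (trans (sumCube-head (suc r′) (deficit ∘ (false ∷_))) (sumCube-pattern false true))

  coordinateDeficit-2+ : ∀ i → coordinateDeficit (suc (suc i)) ≡ d₀₁₂ + d₀₂ + (d₁₂ + d₂)
  coordinateDeficit-2+ i = cong₂ _+_
    (cong₂ _+_ (sumCube-pattern-coordinate true true i) (sumCube-pattern-coordinate true false i))
    (cong₂ _+_ (sumCube-pattern-coordinate false true i) (sumCube-pattern-coordinate false false i))

  coordSum+coordinateDeficit : ∀ i → coordSum i baseSeq + coordinateDeficit i ≡ 2 ^ suc (suc r′) * n₁
  coordSum+coordinateDeficit i = trans (cong (_+ coordinateDeficit i) (coordSum-cubeSeq multiplicity i))
    (sumCube-complement-coordinate (suc (suc r′)) {multiplicity} {deficit} multiplicity+deficit i)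

  private
    rearrange : ∀ a b c d → d + b + (c + a) ≡ a + b + c + d
    rearrange = solve-∀

    rearrange-total : ∀ a b c d e f g n → g + d + (e + a) + (f + b + (c + n)) ≡ a + b + c + d + e + f + g + n
    rearrange-total = solve-∀

  module _ (N∣α+2^ : N ∣ α + 2 ^ suc (suc r′)) where

    private
      divisible : ∀ i {k m} → coordinateDeficit i ≡ α + k + m * N → N ∣ k + coordSum i baseSeq
      divisible i {k} {m} D≡ = divides-complement {σ = coordSum i baseSeq} {P = 2 ^ suc (suc r′)} {α} {k} {m}
                                 (coordSum+coordinateDeficit i) D≡ N∣α+2^

    baseSeq-coordinate₀ : N ∣ extraValue added + coordSum zero baseSeq
    baseSeq-coordinate₀ =
      divisible zero {m = m₀} (trans coordinateDeficit-0 (trans (rearrange d₀ d₀₁ d₀₂ d₀₁₂) deficit₀))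

    baseSeq-coordinate : ∀ i → N ∣ coordSum (suc i) baseSeq
    baseSeq-coordinate zero    = divisible (suc zero) {m = m₁}
      (trans coordinateDeficit-1 (trans (rearrange d₁ d₀₁ d₁₂ d₀₁₂)
        (trans deficit₁ (cong (_+ m₁ * N) (sym (+-identityʳ α))))))
    baseSeq-coordinate (suc i) = divisible (suc (suc i)) {m = m₂}
      (trans (coordinateDeficit-2+ i) (trans (rearrange d₂ d₀₂ d₁₂ d₀₁₂)
        (trans deficit₂ (cong (_+ m₂ * N) (sym (+-identityʳ α))))))

  baseSeq-length : extraCount added + length baseSeq + α + j ≡ (2 ^ r ∸ 1) * n₁
  baseSeq-length = length-complement {f = extraCount added} {α} {j}
    (trans (cong (_+ sumCube r deficit) (length-cubeSeq multiplicity))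
           (sumCube-complement r {multiplicity} {deficit} multiplicity+deficit))
    (trans sumCube-deficit (trans (rearrange-total d₀ d₁ d₂ d₀₁ d₀₂ d₁₂ d₀₁₂ n₁) (cong (_+ n₁) deficit-total)))
    (m^n>0 2 r)

  private
    e₀-bits : Vec Bool r
    e₀-bits = true ∷ replicateᵥ _ false

    deficit-e₀ : deficit e₀-bits ≡ d₀
    deficit-e₀ = cong (maybe (deficitOfPattern true false) 0) (constantValue-replicate r′ false)

    count-e₀ : count e₀ baseSeq ≤ n₁ ∸ d₀
    count-e₀ = begin
      count e₀ baseSeq
        ≡⟨ cong (λ u → count u baseSeq) (cong (suc zero ∷_) (map-replicate bitFin false _)) ⟨
      count (fromBits e₀-bits) baseSeq ≤⟨ count-cubeSeq multiplicity e₀-bits ⟩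
      n₁ ∸ deficit e₀-bits             ≡⟨ cong (n₁ ∸_) deficit-e₀ ⟩
      n₁ ∸ d₀                          ∎
      where open ≤-Reasoning

    multiplicity-zero : multiplicity (replicateᵥ r false) ≡ 0
    multiplicity-zero = trans
      (cong (λ c → n₁ ∸ maybe (deficitOfPattern false false) 0 c) (constantValue-replicate r′ false))
      (n∸n≡0 n₁)

    baseSeq-zeroOne : All ZeroOne baseSeq
    baseSeq-zeroOne = cubeSeq-zeroOne multiplicity

    baseSeq-nonzero : All Nonzero baseSeq
    baseSeq-nonzero = cubeSeq-nonzero multiplicity multiplicity-zero

    baseSeq-count<N : All (λ u → count u baseSeq < N) baseSeq
    baseSeq-count<N = cubeSeq-count<n multiplicity λ b → s≤s (m∸n≤m n₁ (deficit b))

  extra<N : ∀ {k} → k ≤ d₀ → k < N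
  extra<N k≤d₀ = s≤s (≤-trans k≤d₀ d₀≤n₁)

  extendedSeq : Extra d₀ → Seq N r
  extendedSeq noExtra           = baseSeq
  extendedSeq (extra k _ k≤d₀) = axial (fromℕ< (extra<N k≤d₀)) ∷ baseSeq

  length-extendedSeq : ∀ e → length (extendedSeq e) ≡ extraCount e + length baseSeq
  length-extendedSeq noExtra       = refl
  length-extendedSeq (extra _ _ _) = refl

  extendedSeq-zeroSum : N ∣ α + 2 ^ suc (suc r′) →
                        ∀ e → N ∣ extraValue e + coordSum zero baseSeq → ZeroSum (extendedSeq e)
  extendedSeq-zeroSum N∣α+2^ noExtra           N∣σ₀ zero    = N∣σ₀
  extendedSeq-zeroSum N∣α+2^ noExtra           _    (suc i) = baseSeq-coordinate N∣α+2^ i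
  extendedSeq-zeroSum N∣α+2^ (extra k _ k≤d₀) N∣σ₀ zero    =
    subst (λ x → N ∣ x + coordSum zero baseSeq) (sym (toℕ-fromℕ< (extra<N k≤d₀))) N∣σ₀
  extendedSeq-zeroSum N∣α+2^ (extra k _ k≤d₀) _    (suc i) =
    subst (λ x → N ∣ x + coordSum (suc i) baseSeq) (sym (entry-axial-suc (fromℕ< (extra<N k≤d₀)) i))
            (baseSeq-coordinate N∣α+2^ i)

  extendedSeq-shortFree : ∀ e → ¬ HasShortZS (extendedSeq e)
  extendedSeq-shortFree noExtra =
    zeroOne-shortZeroSumFree baseSeq baseSeq-zeroOne baseSeq-nonzero baseSeq-count<N
  extendedSeq-shortFree (extra k 1≤k k≤d₀) =
    axial-shortZeroSumFree baseSeq baseSeq-zeroOne baseSeq-nonzero baseSeq-count<N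
      (fromℕ< k<N) (subst (1 ≤_) (sym k′≡k) 1≤k) (s≤s (begin
        count e₀ baseSeq + toℕ (fromℕ< k<N) ≡⟨ cong (count e₀ baseSeq +_) k′≡k ⟩
        count e₀ baseSeq + k                ≤⟨ +-mono-≤ count-e₀ k≤d₀ ⟩
        n₁ ∸ d₀ + d₀                        ≡⟨ m∸n+n≡m d₀≤n₁ ⟩
        n₁                                  ∎))
    where
    open ≤-Reasoning
    k<N = extra<N k≤d₀
    k′≡k = toℕ-fromℕ< k<N

  deficits⇒shortFreeZeroSum : ∀ {t} → N ∣ α + 2 ^ suc (suc r′) → t + α + j ≡ (2 ^ r ∸ 1) * n₁ →
                              ShortFreeZeroSum N r t
  deficits⇒shortFreeZeroSum N∣α+2^ t+α+j≡s =
    extendedSeq added ,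
    extendedSeq-zeroSum N∣α+2^ added (baseSeq-coordinate₀ N∣α+2^) ,
    trans (length-extendedSeq added) (+-cancelʳ-≡ α _ _ (+-cancelʳ-≡ j _ _ (trans baseSeq-length (sym t+α+j≡s)))) ,
    extendedSeq-shortFree added

-- Deficits realising every admissible j

deficits-below-n₁ : ∀ {n₁ α j} → α ≤ n₁ → j < n₁ → Deficits n₁ α j
deficits-below-n₁ {n₁} {α} {j} α≤n₁ j<n₁ = record
  { d₀ = suc j ; d₁ = 0 ; d₂ = 0 ; d₀₁ = 0 ; d₀₂ = 0 ; d₁₂ = 0 ; d₀₁₂ = α
  ; d₀≤n₁ = j<n₁ ; d₁≤n₁ = z≤n ; d₂≤n₁ = z≤n ; d₀₁≤n₁ = z≤n ; d₀₂≤n₁ = z≤n ; d₁₂≤n₁ = z≤n ; d₀₁₂≤n₁ = α≤n₁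
  ; added = extra (suc j) (s≤s z≤n) ≤-refl
  ; m₀ = 0 ; m₁ = 0 ; m₂ = 0
  ; deficit₀ = eq₀ j α n₁ ; deficit₁ = eq₁ α n₁ ; deficit₂ = eq₁ α n₁ ; deficit-total = eq-total j α
  }
  where
  eq₀ : ∀ j α n₁ → suc j + 0 + 0 + α ≡ α + suc j + 0 * suc n₁
  eq₀ = solve-∀
  eq₁ : ∀ α n₁ → 0 + 0 + 0 + α ≡ α + 0 * suc n₁
  eq₁ = solve-∀
  eq-total : ∀ j α → suc j + 0 + 0 + 0 + 0 + 0 + α ≡ α + j + 1
  eq-total = solve-∀

deficits-at-n₁ : ∀ {n₁ α} → 2 ≤ n₁ → 0 < α → α ≤ n₁ → Deficits n₁ α n₁
deficits-at-n₁ {suc n₁′} {suc α′} (s≤s 1≤n₁′) (s≤s z≤n) α≤n₁ = record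
  { d₀ = suc n₁′ ; d₁ = 1 ; d₂ = 1 ; d₀₁ = 0 ; d₀₂ = 0 ; d₁₂ = 0 ; d₀₁₂ = α′
  ; d₀≤n₁ = ≤-refl ; d₁≤n₁ = s≤s z≤n ; d₂≤n₁ = s≤s z≤n ; d₀₁≤n₁ = z≤n ; d₀₂≤n₁ = z≤n ; d₁₂≤n₁ = z≤n
  ; d₀₁₂≤n₁ = m≤n⇒m≤1+n (s≤s⁻¹ α≤n₁)
  ; added = extra n₁′ 1≤n₁′ (n≤1+n n₁′)
  ; m₀ = 0 ; m₁ = 0 ; m₂ = 0
  ; deficit₀ = eq₀ n₁′ α′ ; deficit₁ = eq₁ n₁′ α′ ; deficit₂ = eq₁ n₁′ α′ ; deficit-total = eq-total n₁′ α′
  }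
  where
  eq₀ : ∀ n₁′ α′ → suc n₁′ + 0 + 0 + α′ ≡ suc α′ + n₁′ + 0 * suc (suc n₁′)
  eq₀ = solve-∀
  eq₁ : ∀ n₁′ α′ → 1 + 0 + 0 + α′ ≡ suc α′ + 0 * suc (suc n₁′)
  eq₁ = solve-∀
  eq-total : ∀ n₁′ α′ → suc n₁′ + 1 + 1 + 0 + 0 + 0 + α′ ≡ suc α′ + suc n₁′ + 1
  eq-total = solve-∀

deficits-above-n₁ : ∀ {n₁ α i} → i < α → α ≤ n₁ → Deficits n₁ α (suc n₁ + i)
deficits-above-n₁ {n₁} {α} {i} i<α α≤n₁ with m≤n⇒∃[o]m+o≡n i<α
... | a , refl = record
  { d₀ = 0 ; d₁ = i ; d₂ = n₁ ; d₀₁ = 0 ; d₀₂ = suc i ; d₁₂ = 1 ; d₀₁₂ = a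
  ; d₀≤n₁ = z≤n ; d₁≤n₁ = ≤-trans (n≤1+n i) 1+i≤n₁ ; d₂≤n₁ = ≤-refl ; d₀₁≤n₁ = z≤n ; d₀₂≤n₁ = 1+i≤n₁
  ; d₁₂≤n₁ = ≤-trans (s≤s z≤n) 1+i≤n₁ ; d₀₁₂≤n₁ = ≤-trans (m≤n+m a (suc i)) α≤n₁
  ; added = noExtra
  ; m₀ = 0 ; m₁ = 0 ; m₂ = 1
  ; deficit₀ = eq₀ n₁ i a ; deficit₁ = eq₁ n₁ i a ; deficit₂ = eq₂ n₁ i a ; deficit-total = eq-total n₁ i a
  }
  where
  1+i≤n₁ : suc i ≤ n₁
  1+i≤n₁ = ≤-trans (m≤m+n (suc i) a) α≤n₁
  eq₀ : ∀ n₁ i a → 0 + 0 + suc i + a ≡ suc i + a + 0 + 0 * suc n₁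
  eq₀ = solve-∀
  eq₁ : ∀ n₁ i a → i + 0 + 1 + a ≡ suc i + a + 0 * suc n₁
  eq₁ = solve-∀
  eq₂ : ∀ n₁ i a → n₁ + suc i + 1 + a ≡ suc i + a + 1 * suc n₁
  eq₂ = solve-∀
  eq-total : ∀ n₁ i a → 0 + i + n₁ + 0 + suc i + 1 + a ≡ suc i + a + (suc n₁ + i) + 0
  eq-total = solve-∀

deficits-at-n₁+α+1 : ∀ {n₁ α} → 0 < α → α ≤ n₁ → Deficits n₁ α (suc n₁ + α)
deficits-at-n₁+α+1 {n₁} {suc w} (s≤s z≤n) α≤n₁ = record
  { d₀ = w ; d₁ = 0 ; d₂ = 0 ; d₀₁ = 1 ; d₀₂ = 1 ; d₁₂ = suc w ; d₀₁₂ = n₁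
  ; d₀≤n₁ = ≤-trans (n≤1+n w) α≤n₁ ; d₁≤n₁ = z≤n ; d₂≤n₁ = z≤n ; d₀₁≤n₁ = ≤-trans (s≤s z≤n) α≤n₁
  ; d₀₂≤n₁ = ≤-trans (s≤s z≤n) α≤n₁ ; d₁₂≤n₁ = α≤n₁ ; d₀₁₂≤n₁ = ≤-refl
  ; added = noExtra
  ; m₀ = 1 ; m₁ = 1 ; m₂ = 1
  ; deficit₀ = eq₀ n₁ w ; deficit₁ = eq₁ n₁ w ; deficit₂ = eq₁ n₁ w ; deficit-total = eq-total n₁ w
  }
  where
  eq₀ : ∀ n₁ w → w + 1 + 1 + n₁ ≡ suc w + 0 + 1 * suc n₁
  eq₀ = solve-∀
  eq₁ : ∀ n₁ w → 0 + 1 + suc w + n₁ ≡ suc w + 1 * suc n₁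
  eq₁ = solve-∀
  eq-total : ∀ n₁ w → w + 0 + 0 + 1 + 1 + suc w + n₁ ≡ suc w + (suc n₁ + suc w) + 0
  eq-total = solve-∀

deficits-beyond-n₁+α+1 : ∀ {n₁ α v} → v < α → α ≤ n₁ → Deficits n₁ α (suc n₁ + (suc α + v))
deficits-beyond-n₁+α+1 {n₁} {α} {v} v<α α≤n₁ with m≤n⇒∃[o]m+o≡n v<α
... | w , refl = record
  { d₀ = w + v ; d₁ = suc v ; d₂ = suc v ; d₀₁ = 1 ; d₀₂ = 1 ; d₁₂ = w ; d₀₁₂ = n₁
  ; d₀≤n₁ = ≤-trans (≤-reflexive (+-comm w v)) (≤-trans (n≤1+n (v + w)) α≤n₁) ; d₁≤n₁ = 1+v≤n₁ ; d₂≤n₁ = 1+v≤n₁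
  ; d₀₁≤n₁ = ≤-trans (s≤s z≤n) 1+v≤n₁ ; d₀₂≤n₁ = ≤-trans (s≤s z≤n) 1+v≤n₁
  ; d₁₂≤n₁ = ≤-trans (m≤n+m w (suc v)) α≤n₁ ; d₀₁₂≤n₁ = ≤-refl
  ; added = noExtra
  ; m₀ = 1 ; m₁ = 1 ; m₂ = 1
  ; deficit₀ = eq₀ n₁ v w ; deficit₁ = eq₁ n₁ v w ; deficit₂ = eq₁ n₁ v w ; deficit-total = eq-total n₁ v w
  }
  where
  1+v≤n₁ : suc v ≤ n₁
  1+v≤n₁ = ≤-trans (m≤m+n (suc v) w) α≤n₁
  eq₀ : ∀ n₁ v w → w + v + 1 + 1 + n₁ ≡ suc v + w + 0 + 1 * suc n₁
  eq₀ = solve-∀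
  eq₁ : ∀ n₁ v w → suc v + 1 + w + n₁ ≡ suc v + w + 1 * suc n₁
  eq₁ = solve-∀
  eq-total : ∀ n₁ v w → w + v + suc v + suc v + 1 + 1 + w + n₁ ≡ suc v + w + (suc n₁ + (suc (suc v + w) + v)) + 0
  eq-total = solve-∀

deficits-high-even : ∀ {α y u} → Deficits (suc (α + y) + u) α (suc (suc (α + y) + u) + (suc α + (α + (y + y))))
deficits-high-even {α} {y} {u} = record
  { d₀ = α + y ; d₁ = α + y ; d₂ = suc (α + y) ; d₀₁ = 1 ; d₀₂ = 0 ; d₁₂ = 0 ; d₀₁₂ = suc α + u
  ; d₀≤n₁ = α+y≤n₁ ; d₁≤n₁ = α+y≤n₁ ; d₂≤n₁ = m≤m+n _ u ; d₀₁≤n₁ = s≤s z≤n ; d₀₂≤n₁ = z≤n ; d₁₂≤n₁ = z≤n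
  ; d₀₁₂≤n₁ = +-monoˡ-≤ u (s≤s (m≤m+n α y))
  ; added = noExtra
  ; m₀ = 1 ; m₁ = 1 ; m₂ = 1
  ; deficit₀ = eq₀ α y u ; deficit₁ = eq₁ α y u ; deficit₂ = eq₂ α y u ; deficit-total = eq-total α y u
  }
  where
  α+y≤n₁ : α + y ≤ suc (α + y) + u
  α+y≤n₁ = ≤-trans (n≤1+n _) (m≤m+n _ u)
  eq₀ : ∀ α y u → α + y + 1 + 0 + (suc α + u) ≡ α + 0 + 1 * suc (suc (α + y) + u)
  eq₀ = solve-∀
  eq₁ : ∀ α y u → α + y + 1 + 0 + (suc α + u) ≡ α + 1 * suc (suc (α + y) + u)
  eq₁ = solve-∀
  eq₂ : ∀ α y u → suc (α + y) + 0 + 0 + (suc α + u) ≡ α + 1 * suc (suc (α + y) + u)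
  eq₂ = solve-∀
  eq-total : ∀ α y u → α + y + (α + y) + suc (α + y) + 1 + 0 + 0 + (suc α + u) ≡
                       α + (suc (suc (α + y) + u) + (suc α + (α + (y + y)))) + 0
  eq-total = solve-∀

deficits-high-odd : ∀ {α y u} → Deficits (suc (α + y) + u) α (suc (suc (α + y) + u) + (suc α + (α + suc (y + y))))
deficits-high-odd {α} {y} {u} = record
  { d₀ = suc (α + y) ; d₁ = suc (α + y) ; d₂ = suc (α + y) ; d₀₁ = 0 ; d₀₂ = 0 ; d₁₂ = 0 ; d₀₁₂ = suc α + u
  ; d₀≤n₁ = 1+α+y≤n₁ ; d₁≤n₁ = 1+α+y≤n₁ ; d₂≤n₁ = 1+α+y≤n₁ ; d₀₁≤n₁ = z≤n ; d₀₂≤n₁ = z≤n ; d₁₂≤n₁ = z≤n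
  ; d₀₁₂≤n₁ = +-monoˡ-≤ u (s≤s (m≤m+n α y))
  ; added = noExtra
  ; m₀ = 1 ; m₁ = 1 ; m₂ = 1
  ; deficit₀ = eq₀ α y u ; deficit₁ = eq₁ α y u ; deficit₂ = eq₁ α y u ; deficit-total = eq-total α y u
  }
  where
  1+α+y≤n₁ : suc (α + y) ≤ suc (α + y) + u
  1+α+y≤n₁ = m≤m+n _ u
  eq₀ : ∀ α y u → suc (α + y) + 0 + 0 + (suc α + u) ≡ α + 0 + 1 * suc (suc (α + y) + u)
  eq₀ = solve-∀
  eq₁ : ∀ α y u → suc (α + y) + 0 + 0 + (suc α + u) ≡ α + 1 * suc (suc (α + y) + u)
  eq₁ = solve-∀
  eq-total : ∀ α y u → suc (α + y) + suc (α + y) + suc (α + y) + 0 + 0 + 0 + (suc α + u) ≡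
                       α + (suc (suc (α + y) + u) + (suc α + (α + suc (y + y)))) + 0
  eq-total = solve-∀

even-or-odd : ∀ g → ∃[ y ] (g ≡ y + y ⊎ g ≡ suc (y + y))
even-or-odd zero = 0 , inj₁ refl
even-or-odd (suc g) with even-or-odd g
... | y , inj₁ refl = y , inj₂ refl
... | y , inj₂ refl = suc y , inj₁ (cong suc (sym (+-suc y y)))

high-range-bound : ∀ {n₁ α y g} → y + y ≤ g → suc n₁ + (suc α + (α + g)) ≤ 3 * n₁ → suc (α + y) ≤ n₁
high-range-bound {n₁} {α} {y} {g} 2y≤g j≤3n₁ = *-cancelˡ-≤ 2 (+-cancelˡ-≤ n₁ _ _ (begin
  n₁ + 2 * suc (α + y)                  ≡⟨ regroup n₁ α y ⟩
  suc n₁ + (suc α + (α + (y + y)))      ≤⟨ +-monoʳ-≤ (suc n₁) (+-monoʳ-≤ (suc α) (+-monoʳ-≤ α 2y≤g)) ⟩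
  suc n₁ + (suc α + (α + g))            ≤⟨ j≤3n₁ ⟩
  3 * n₁                                ≡⟨ triple n₁ ⟩
  n₁ + 2 * n₁                           ∎))
  where
  open ≤-Reasoning
  regroup : ∀ n₁ α y → n₁ + 2 * suc (α + y) ≡ suc n₁ + (suc α + (α + (y + y)))
  regroup = solve-∀
  triple : ∀ n₁ → 3 * n₁ ≡ n₁ + 2 * n₁
  triple = solve-∀

deficits-high : ∀ {n₁ α g} → suc n₁ + (suc α + (α + g)) ≤ 3 * n₁ → Deficits n₁ α (suc n₁ + (suc α + (α + g)))
deficits-high {n₁} {α} {g} j≤3n₁ with even-or-odd g
... | y , inj₁ refl with m≤n⇒∃[o]m+o≡n {suc (α + y)} (high-range-bound {y = y} ≤-refl j≤3n₁)
...   | u , refl = deficits-high-even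
deficits-high {n₁} {α} {g} j≤3n₁ | y , inj₂ refl
  with m≤n⇒∃[o]m+o≡n {suc (α + y)} (high-range-bound {y = y} (n≤1+n _) j≤3n₁)
...   | u , refl = deficits-high-odd

α-positive : ∀ {n₁ α j} → α ≢ 0 ⊎ suc (suc n₁) ≤ j → j ≤ suc n₁ + α → 0 < α
α-positive (inj₁ α≢0) _ = n≢0⇒n>0 α≢0
α-positive {n₁} {zero} {j} (inj₂ 2+n₁≤j) j≤1+n₁+0 =
  contradiction (≤-trans 2+n₁≤j (subst (j ≤_) (+-identityʳ _) j≤1+n₁+0)) (n≮n (suc n₁))
α-positive {α = suc _} (inj₂ _) _ = s≤s z≤n

deficits-exist : ∀ {n₁ α j} → 2 ≤ n₁ → α ≤ n₁ → α ≢ 0 ⊎ suc (suc n₁) ≤ j → j ≤ 3 * n₁ → Deficits n₁ α j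
deficits-exist {n₁} {α} {j} 2≤n₁ α≤n₁ α≢0⊎j≥ j≤3n₁ with <-cmp j n₁
... | tri< j<n₁ _ _ = deficits-below-n₁ α≤n₁ j<n₁
... | tri≈ _ refl _ =
  deficits-at-n₁ 2≤n₁ (α-positive α≢0⊎j≥ (≤-trans (n≤1+n n₁) (m≤m+n (suc n₁) α))) α≤n₁
... | tri> _ _ n₁<j with m≤n⇒∃[o]m+o≡n n₁<j
...   | i , refl with <-cmp i α
...     | tri< i<α _ _ = deficits-above-n₁ i<α α≤n₁
...     | tri≈ _ refl _ = deficits-at-n₁+α+1 (α-positive α≢0⊎j≥ ≤-refl) α≤n₁
...     | tri> _ _ α<i with m≤n⇒∃[o]m+o≡n α<i
...       | v , refl with v <? α
...         | yes v<α = deficits-beyond-n₁+α+1 v<α α≤n₁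
...         | no v≮α with m≤n⇒∃[o]m+o≡n (≮⇒≥ v≮α)
...           | g , refl = deficits-high j≤3n₁

shortFreeZeroSum⇒¬InC0 : ∀ {n r t} → ShortFreeZeroSum n r t → ¬ InC0 n r t
shortFreeZeroSum⇒¬InC0 (S , zeroSum , ℓ≡t , shortFree) (_ , _ , _ , _ , _ , _ , allShort) =
  shortFree (allShort S zeroSum ℓ≡t)

¬InC0-of-deficit-range : ∀ {n₁ r′ α j t} → 2 ≤ n₁ → α ≤ n₁ → suc n₁ ∣ α + 2 ^ suc (suc r′) →
                         α ≢ 0 ⊎ suc (suc n₁) ≤ j → j ≤ 3 * n₁ →
                         t + α + j ≡ (2 ^ suc (suc (suc r′)) ∸ 1) * n₁ → ¬ InC0 (suc n₁) (suc (suc (suc r′))) t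
¬InC0-of-deficit-range {suc _} {r′} 2≤n₁@(s≤s _) α≤n₁ n∣α+2^ α≢0⊎j≥ j≤3n₁ t+α+j≡s =
  shortFreeZeroSum⇒¬InC0
    (deficits⇒shortFreeZeroSum {r′ = r′} (deficits-exist 2≤n₁ α≤n₁ α≢0⊎j≥ j≤3n₁) n∣α+2^ t+α+j≡s)

m∸n≤o⇒m≤n+o : ∀ m n {o} → m ∸ n ≤ o → m ≤ n + o
m∸n≤o⇒m≤n+o m       zero    m≤o = m≤o
m∸n≤o⇒m≤n+o zero    (suc n) _   = z≤n
m∸n≤o⇒m≤n+o (suc m) (suc n) le  = s≤s (m∸n≤o⇒m≤n+o m n le)

∸-window : ∀ s a b c {t} → c + b ≤ s → s ∸ a ∸ b ≤ t → t ≤ s ∸ b ∸ c →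
           t + b + (s ∸ (t + b)) ≡ s × c ≤ s ∸ (t + b) × s ∸ (t + b) ≤ a
∸-window s a b c {t} c+b≤s lower upper =
  m+[n∸m]≡n t+b≤s ,
  m+n≤o⇒m≤o∸n c (subst (_≤ s) (regroup₁ t c b) t+c+b≤s) ,
  m≤n+o⇒m∸n≤o s (t + b) (begin
    s             ≤⟨ m∸n≤o⇒m≤n+o s a (m∸n≤o⇒m≤n+o (s ∸ a) b lower) ⟩
    a + (b + t)   ≡⟨ regroup₂ a b t ⟩
    t + b + a     ∎)
  where
  open ≤-Reasoning
  b≤s : b ≤ s
  b≤s = ≤-trans (m≤n+m b c) c+b≤s
  t+c+b≤s : t + c + b ≤ s
  t+c+b≤s = m≤o∸n⇒m+n≤o (t + c) b≤s (m≤o∸n⇒m+n≤o t (m+n≤o⇒m≤o∸n c c+b≤s) upper)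
  t+b≤s : t + b ≤ s
  t+b≤s = ≤-trans (+-monoˡ-≤ b (m≤m+n t c)) t+c+b≤s
  regroup₁ : ∀ t c b → t + c + b ≡ c + (t + b)
  regroup₁ = solve-∀
  regroup₂ : ∀ a b t → a + (b + t) ≡ t + b + a
  regroup₂ = solve-∀

3≤2^[3+k]∸1 : ∀ k → 3 ≤ 2 ^ suc (suc (suc k)) ∸ 1
3≤2^[3+k]∸1 k = ∸-monoˡ-≤ 1 (*-monoʳ-≤ 2 (*-monoʳ-≤ 2 (m^n>0 2 (suc k))))

lemma3p5 : (n r : ℕ) → 3 ≤ n → 3 ≤ r →
    (α : ℕ) → α < n → n ∣ α + 2 ^ (r ∸ 1) →
    (α ≢ 0 →
       (t : ℕ) → (2 ^ r ∸ 1) * (n ∸ 1) ∸ (3 * n ∸ 3) ∸ α ≤ t →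
       t ≤ (2 ^ r ∸ 1) * (n ∸ 1) ∸ α → ¬ InC0 n r t)
    ×
    (α ≡ 0 →
       (t : ℕ) → (2 ^ r ∸ 1) * (n ∸ 1) ∸ (3 * n ∸ 3) ≤ t →
       t ≤ (2 ^ r ∸ 1) * (n ∸ 1) ∸ (n + 1) → ¬ InC0 n r t)
lemma3p5 (suc n₁@(suc (suc n₃))) (suc (suc (suc r′))) (s≤s 2≤n₁@(s≤s (s≤s z≤n))) (s≤s (s≤s (s≤s z≤n)))
         α (s≤s α≤n₁) n∣α+2^ =
  (λ α≢0 t lower upper →
     let t+α+j≡s , _ , j≤3n-3 = ∸-window s (3 * suc n₁ ∸ 3) α 0 α≤s lower upper
     in excluded (inj₁ α≢0) j≤3n-3 t+α+j≡s) ,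
  (λ { refl t lower upper →
     let t+j≡s , n+1≤j , j≤3n-3 = ∸-window s (3 * suc n₁ ∸ 3) 0 (suc n₁ + 1) n+1≤s lower upper
     in excluded (inj₂ (subst (_≤ s ∸ (t + 0)) (+-comm (suc n₁) 1) n+1≤j)) j≤3n-3 t+j≡s })
  where
  s : ℕ
  s = (2 ^ suc (suc (suc r′)) ∸ 1) * n₁
  3n₁≤s : 3 * n₁ ≤ s
  3n₁≤s = *-monoˡ-≤ n₁ (3≤2^[3+k]∸1 r′)
  α≤s : α ≤ s
  α≤s = ≤-trans α≤n₁ (≤-trans (m≤n*m n₁ 3) 3n₁≤s)
  n+1≤s : suc n₁ + 1 + 0 ≤ s
  n+1≤s = ≤-trans (≤-trans (m≤m+n _ (n₃ + n₃ + 2)) (≤-reflexive (pad n₃))) 3n₁≤s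
    where
    pad : ∀ n₃ → suc (suc (suc n₃)) + 1 + 0 + (n₃ + n₃ + 2) ≡ 3 * suc (suc n₃)
    pad = solve-∀
  excluded : ∀ {t j} → α ≢ 0 ⊎ suc (suc n₁) ≤ j → j ≤ 3 * suc n₁ ∸ 3 → t + α + j ≡ s →
             ¬ InC0 (suc n₁) (suc (suc (suc r′))) t
  excluded {j = j} α≢0⊎j≥ j≤3n-3 =
    ¬InC0-of-deficit-range {r′ = r′} 2≤n₁ α≤n₁ n∣α+2^ α≢0⊎j≥ (subst (j ≤_) 3n-3≡3n₁ j≤3n-3)
    where
    3n-3≡3n₁ : 3 * suc n₁ ∸ 3 ≡ 3 * n₁
    3n-3≡3n₁ = trans (cong (_∸ 3) (*-suc 3 n₁)) (m+n∸m≡n 3 (3 * n₁))
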